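{- For all ITrees $P,Q,R,P':(E,S)\mathsf{itree}$, partial functions $F$, events $e$, values $x,y$ and event lists $tr,tr_1,tr_2$: (i) if $P\xrightarrow{tr_1}Q$ and $Q\xrightarrow{tr_2}R$ then $P\xrightarrow{tr_1\mathbin{@}tr_2}R$; (ii) if $P\xrightarrow{tr}\mathsf{Vis}\,F$ and $P\xrightarrow{tr\mathbin{@}[e]}P'$ then $e\in\mathrm{dom}(F)$; (iii) if $P\xrightarrow{tr}\mathsf{Ret}\,x$ and $P\xrightarrow{tr}\mathsf{Ret}\,y$ then $x=y$; (iv) if $P\xrightarrow{tr_1}Q$ and $tr_2$ is a prefix of $tr_1$ then there exists $R$ with $P\xrightarrow{tr_2}R$.
   Context: Fix a type $E$ of events. For a type $S$, $(E,S)\mathsf{itree}$ is the codatatype with constructors $\mathsf{Ret}\,r$ ($r\in S$), $\mathsf{Sil}\,P$ written $\tau P$, and $\mathsf{Vis}\,F$ with $F:E\rightharpoonup(E,S)\mathsf{itree}$ a partial function with domain $\mathrm{dom}(F)$. The transition relation $P\xrightarrow{tr}P'$, for $tr$ a finite list of events, is the least relation such that: $P\xrightarrow{[]}P$ for all $P$; if $P\xrightarrow{tr}P'$ then $\tau P\xrightarrow{tr}P'$; if $e\in\mathrm{dom}(F)$ and $F(e)\xrightarrow{tr}P'$ then $\mathsf{Vis}\,F\xrightarrow{e\#tr}P'$, where $e\#tr$ is the list with head $e$ and tail $tr$. $\mathbin{@}$ denotes list concatenation. -}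

module Defs where

open import Data.List using (List; []; _∷_)
open import Data.Maybe using (Maybe; just)
open import Data.Product using (∃)
open import Relation.Binary.PropositionalEquality using (_≡_)

data ITreeF (E S X : Set) : Set where
  Ret : S → ITreeF E S X
  Sil : X → ITreeF E S X
  Vis : (E → Maybe X) → ITreeF E S X

-- The theorem is
-- stated for every such structure, in particular for the final coalgebra
-- (the genuine codatatype).  A tree P "is" Ret r / τ Q / Vis F exactly
-- when out P ≡ Ret r / Sil Q / Vis F.
record ITree (E S : Set) : Set₁ where
  field
    Tree : Set
    out  : Tree → ITreeF E S Tree

dom : {A B : Set} → (A → Maybe B) → A → Set
dom F e = ∃ λ b → F e ≡ just b

module Trans {E S : Set} (I : ITree E S) where
  open ITree I

  data _─[_]→_ : Tree → List E → Tree → Set where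
    t-nil : ∀ {P} → P ─[ [] ]→ P
    t-sil : ∀ {P Q tr P'} → out P ≡ Sil Q → Q ─[ tr ]→ P' → P ─[ tr ]→ P'
    t-vis : ∀ {P F e Q tr P'} → out P ≡ Vis F → F e ≡ just Q → Q ─[ tr ]→ P'
          → P ─[ e ∷ tr ]→ P'

-- A run along a trace is determined up to where it stops among τ-steps: if two
-- runs along the same trace both stop at a tree that is not τ, they stop at
-- the same tree, because at τ and Vis nodes the next step is forced by the
-- tree and the next event.  (iii) is this determinism for two Ret trees.  For
-- (ii), a run along tr ++ [e] must pass, after tr, through a Vis node enabling
-- e; by determinism that node is Q itself.
module Submission where

open import Defs
open import Data.Empty using (⊥-elim)
open import Data.List using (List; []; _∷_; _++_; [_])
open import Data.Maybe using (Maybe)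
open import Data.Product using (_×_; ∃; ∃-syntax; _,_)
open import Relation.Binary.PropositionalEquality using (_≡_; _≢_; refl; sym; trans)
open import Data.List.Relation.Binary.Prefix.Heterogeneous using (Prefix; []; _∷_)

module Properties {E S : Set} (I : ITree E S) where
  open ITree I
  open Trans I

  ++-trans : ∀ {P Q R tr₁ tr₂} → P ─[ tr₁ ]→ Q → Q ─[ tr₂ ]→ R → P ─[ tr₁ ++ tr₂ ]→ R
  ++-trans t-nil         q = q
  ++-trans (t-sil o p)   q = t-sil o (++-trans p q)
  ++-trans (t-vis o f p) q = t-vis o f (++-trans p q)

  prefix-closed : ∀ {P Q tr₁ tr₂} → P ─[ tr₁ ]→ Q → Prefix _≡_ tr₂ tr₁ → ∃[ R ] P ─[ tr₂ ]→ R
  prefix-closed {P} p [] = P , t-nil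
  prefix-closed (t-sil o p) pre@(_ ∷ _) with prefix-closed p pre
  ... | R , r = R , t-sil o r
  prefix-closed (t-vis o f p) (refl ∷ pre) with prefix-closed p pre
  ... | R , r = R , t-vis o f r

  Stable : Tree → Set
  Stable P = ∀ {Q} → out P ≢ Sil Q

  ret⇒stable : ∀ {P x} → out P ≡ Ret x → Stable P
  ret⇒stable o o' with trans (sym o) o'
  ... | ()

  vis⇒stable : ∀ {P F} → out P ≡ Vis F → Stable P
  vis⇒stable o o' with trans (sym o) o'
  ... | ()

  Enables : Tree → E → Set
  Enables P e = ∃[ F ] out P ≡ Vis F × dom F e

  stable-deterministic : ∀ {P Q Q' tr} → Stable Q → Stable Q'
    → P ─[ tr ]→ Q → P ─[ tr ]→ Q' → Q ≡ Q'
  stable-deterministic _  _   t-nil         t-nil           = refl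
  stable-deterministic sQ _   t-nil         (t-sil o' _)    = ⊥-elim (sQ o')
  stable-deterministic _  sQ' (t-sil o _)   t-nil           = ⊥-elim (sQ' o)
  stable-deterministic sQ sQ' (t-sil o p)   (t-sil o' q)    with trans (sym o) o'
  ... | refl = stable-deterministic sQ sQ' p q
  stable-deterministic _  _   (t-sil o _)   (t-vis o' _ _)  with trans (sym o) o'
  ... | ()
  stable-deterministic _  _   (t-vis o _ _) (t-sil o' _)    with trans (sym o) o'
  ... | ()
  stable-deterministic sQ sQ' (t-vis o f p) (t-vis o' f' q) with trans (sym o) o'
  ... | refl with trans (sym f) f'
  ...   | refl = stable-deterministic sQ sQ' p q

  enabled-before-event : ∀ {P R e tr'} tr → P ─[ tr ++ e ∷ tr' ]→ R
    → ∃[ M ] P ─[ tr ]→ M × Enables M e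
  enabled-before-event [] (t-sil o p) with enabled-before-event [] p
  ... | M , m , en = M , t-sil o m , en
  enabled-before-event {P} [] (t-vis o f _) = P , t-nil , _ , o , _ , f
  enabled-before-event (_ ∷ tr) (t-sil o p) with enabled-before-event (_ ∷ tr) p
  ... | M , m , en = M , t-sil o m , en
  enabled-before-event (_ ∷ tr) (t-vis o f p) with enabled-before-event tr p
  ... | M , m , en = M , t-vis o f m , en

  vis-enables-next : ∀ {P Q P' F e} tr → P ─[ tr ]→ Q → out Q ≡ Vis F
    → P ─[ tr ++ [ e ] ]→ P' → dom F e
  vis-enables-next tr q oQ p with enabled-before-event tr p
  ... | M , m , G , oM , e∈G with stable-deterministic (vis⇒stable oQ) (vis⇒stable oM) q m
  ...   | refl with trans (sym oQ) oM
  ...     | refl = e∈G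

  ret-deterministic : ∀ {P Q Q' x y tr} → P ─[ tr ]→ Q → out Q ≡ Ret x
    → P ─[ tr ]→ Q' → out Q' ≡ Ret y → x ≡ y
  ret-deterministic q oQ q' oQ'
    with stable-deterministic (ret⇒stable oQ) (ret⇒stable oQ') q q'
  ... | refl with trans (sym oQ) oQ'
  ...   | refl = refl

theorem3p10 : {E S : Set} (I : ITree E S)
    → let open ITree I
          open Trans I
      in (∀ (P Q R : Tree) (tr₁ tr₂ : List E)
            → P ─[ tr₁ ]→ Q → Q ─[ tr₂ ]→ R → P ─[ tr₁ ++ tr₂ ]→ R)
       × (∀ (P Q P' : Tree) (F : E → Maybe Tree) (e : E) (tr : List E)
            → P ─[ tr ]→ Q → out Q ≡ Vis F → P ─[ tr ++ [ e ] ]→ P' → dom F e)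
       × (∀ (P Q Q' : Tree) (x y : S) (tr : List E)
            → P ─[ tr ]→ Q → out Q ≡ Ret x → P ─[ tr ]→ Q' → out Q' ≡ Ret y → x ≡ y)
       × (∀ (P Q : Tree) (tr₁ tr₂ : List E)
            → P ─[ tr₁ ]→ Q → Prefix _≡_ tr₂ tr₁ → ∃ λ R → P ─[ tr₂ ]→ R)
theorem3p10 I =
    (λ _ _ _ _ _ → ++-trans)
  , (λ _ _ _ _ _ tr → vis-enables-next tr)
  , (λ _ _ _ _ _ _ → ret-deterministic)
  , (λ _ _ _ _ → prefix-closed)
  where open Properties I
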